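{- Let $\pi,\sigma\in S_n$ with $\pi=q(\sigma)$. Let $\pi_i$ be an LTR maximum of $\pi$ for some $i<n$. If $\pi_{i+1}$ is not an LTR maximum of $\pi$, then $\pi_i$ is not an LTR maximum of $\sigma$.
   Context: $S_n$ is the set of permutations of $\{1,\dots,n\}$ in one-line notation $\pi=\pi_1\cdots\pi_n$. An entry $\pi_i$ is a left-to-right (LTR) maximum if $\pi_i>\pi_j$ for all $j<i$. The map $q:S_n\to S_n$ (the algorithm Queuesort, sorting with a queue allowing bypass): let $m_1,\dots,m_r$ be the LTR maxima of $\pi$ from left to right; for $i=r,\dots,1$ in this order, repeatedly swap $m_i$ with the entry immediately to its right as long as such an entry exists and is smaller than $m_i$; the result is $q(\pi)$. -}

module Defs where

open import Data.Nat using (ℕ; zero; suc; _<_; _<ᵇ_)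
open import Data.Bool using (if_then_else_)
open import Data.List using (List; []; _∷_; length; lookup; applyUpTo)
open import Data.Fin as Fin using (Fin)
open import Data.Product using (Σ; _×_)
open import Relation.Binary.PropositionalEquality using (_≡_)
open import Data.List.Relation.Binary.Permutation.Propositional using (_↭_)

IsPerm : ℕ → List ℕ → Set
IsPerm n l = l ↭ applyUpTo suc n

bubble : ℕ → List ℕ → List ℕ
bubble x [] = x ∷ []
bubble x (y ∷ ys) = if y <ᵇ x then y ∷ bubble x ys else x ∷ y ∷ ys

-- qAux m xs: Queuesort applied to the suffix xs, where m is the maximum
-- of the entries preceding xs (0 if none).  The suffix after an LTR
-- maximum x is processed first (its LTR maxima lie to the right of x,
-- hence are treated before x), then x is bubbled to the right.
qAux : ℕ → List ℕ → List ℕ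
qAux m [] = []
qAux m (x ∷ xs) = if m <ᵇ x then bubble x (qAux x xs) else x ∷ qAux m xs

-- Queuesort (sorting with a queue allowing bypass).
q : List ℕ → List ℕ
q = qAux 0

IsLTRMax : (l : List ℕ) → Fin (length l) → Set
IsLTRMax l i = ∀ (j : Fin (length l)) → j Fin.< i → lookup l j < lookup l i

IsLTRMaxValue : List ℕ → ℕ → Set
IsLTRMaxValue l v = Σ (Fin (length l)) (λ i → (lookup l i ≡ v) × IsLTRMax l i)

-- Queuesort processes LTR maxima from right to left. When an LTR maximum w of σ
-- is bubbled, everything to its right has already been processed and w stops at the
-- end or in front of an entry ≥ w; bubbling the earlier, smaller LTR maxima only
-- moves entries from before w to before w. So in q σ the entry after w is larger
-- than w (entries are distinct), and if w is an LTR maximum of q σ, so is that entry.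
module Submission where

open import Defs
open import Data.Nat using (ℕ; suc; _<_; _≤_; _<ᵇ_; z<s; s<s)
open import Data.Nat.Properties
  using (<ᵇ-reflects-<; <-asym; ≮⇒≥; ≤∧≢⇒<; <-trans; suc-injective; m<1+n⇒m<n∨m≡n; <⇒≢)
open import Data.Bool using (true; false)
open import Data.List using (List; []; _∷_; length; lookup; _++_; applyUpTo)
open import Data.Fin as Fin using (Fin; toℕ)
open import Data.Fin.Properties using (toℕ-injective)
open import Data.Product using (_,_)
open import Data.Sum using (inj₁; inj₂)
open import Data.Empty using (⊥-elim)
open import Relation.Nullary using (¬_)
open import Relation.Nullary.Reflects using (ofʸ; ofⁿ)
open import Relation.Binary.PropositionalEquality using (_≡_; refl; sym; subst; setoid)
open import Data.List.Relation.Binary.Permutation.Propositional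
  using (_↭_; ↭-sym; ↭-trans; ↭-refl; ↭-prep; ↭-swap; ↭⇒↭ₛ)
open import Data.List.Relation.Binary.Permutation.Propositional.Properties using (∈-resp-↭)
open import Data.List.Relation.Binary.Permutation.Setoid.Properties (setoid ℕ) using (Unique-resp-↭)
open import Data.List.Relation.Unary.AllPairs using (_∷_)
import Data.List.Relation.Unary.All as All
open import Data.List.Relation.Unary.Any using (here)
open import Data.List.Relation.Unary.Unique.Propositional using (Unique)
open import Data.List.Relation.Unary.Unique.Propositional.Properties using (applyUpTo⁺₁)
open import Data.List.Membership.Propositional using (_∈_)
open import Data.List.Membership.Propositional.Properties using (∈-lookup; ∈-applyUpTo⁻; ∈-++⁺ʳ)

private
  variable
    v x : ℕ
    l bs : List ℕ

ltrMax-successor : (l : List ℕ) (i j : Fin (length l)) → toℕ j ≡ suc (toℕ i) →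
  IsLTRMax l i → lookup l i < lookup l j → IsLTRMax l j
ltrMax-successor l i j j≡1+i ltr-i li<lj k k<j
  with m<1+n⇒m<n∨m≡n (subst (toℕ k <_) j≡1+i k<j)
... | inj₁ k<i = <-trans (ltr-i k k<i) li<lj
... | inj₂ k≡i rewrite toℕ-injective k≡i = li<lj

bubble-↭ : ∀ x ys → bubble x ys ↭ x ∷ ys
bubble-↭ x [] = ↭-refl
bubble-↭ x (y ∷ ys) with y <ᵇ x | <ᵇ-reflects-< y x
... | true  | ofʸ _ = ↭-trans (↭-prep y (bubble-↭ x ys)) (↭-swap y x ↭-refl)
... | false | ofⁿ _ = ↭-refl

qAux-↭ : ∀ m xs → qAux m xs ↭ xs
qAux-↭ m [] = ↭-refl
qAux-↭ m (x ∷ xs) with m <ᵇ x | <ᵇ-reflects-< m x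
... | true  | ofʸ _ = ↭-trans (bubble-↭ x (qAux x xs)) (↭-prep x (qAux-↭ x xs))
... | false | ofⁿ _ = ↭-prep x (qAux-↭ m xs)

perm-unique : ∀ n → IsPerm n l → Unique l
perm-unique n l-perm =
  Unique-resp-↭ (↭⇒↭ₛ (↭-sym l-perm)) (applyUpTo⁺₁ suc n (λ i<j _ → <⇒≢ (s<s i<j)))

perm-positive : ∀ n → IsPerm n l → x ∈ l → 0 < x
perm-positive n l-perm x∈l with ∈-applyUpTo⁻ suc (∈-resp-↭ l-perm x∈l)
... | _ , _ , refl = z<s

data _≤head_ (v : ℕ) : List ℕ → Set where
  ≤head-[] : v ≤head []
  ≤head-∷  : ∀ {b} → v ≤ b → v ≤head (b ∷ bs)

-- The positions at which bubbling v can stop.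
data Blocked (v : ℕ) : List ℕ → Set where
  blocked : ∀ as → v ≤head bs → Blocked v (as ++ v ∷ bs)

∷-blocked : ∀ x → Blocked v l → Blocked v (x ∷ l)
∷-blocked x (blocked as v≤bs) = blocked (x ∷ as) v≤bs

bubble-blocked-self : ∀ v ys → Blocked v (bubble v ys)
bubble-blocked-self v [] = blocked [] ≤head-[]
bubble-blocked-self v (y ∷ ys) with y <ᵇ v | <ᵇ-reflects-< y v
... | true  | ofʸ _   = ∷-blocked y (bubble-blocked-self v ys)
... | false | ofⁿ y≮v = blocked [] (≤head-∷ (≮⇒≥ y≮v))

bubble-++-blocked : x < v → ∀ as → v ≤head bs → Blocked v (bubble x (as ++ v ∷ bs))
bubble-++-blocked {x} {v} x<v [] v≤bs with v <ᵇ x | <ᵇ-reflects-< v x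
... | true  | ofʸ v<x = ⊥-elim (<-asym x<v v<x)
... | false | ofⁿ _   = blocked (x ∷ []) v≤bs
bubble-++-blocked {x} x<v (a ∷ as) v≤bs with a <ᵇ x | <ᵇ-reflects-< a x
... | true  | ofʸ _ = ∷-blocked a (bubble-++-blocked x<v as v≤bs)
... | false | ofⁿ _ = blocked (x ∷ a ∷ as) v≤bs

bubble-blocked : x < v → Blocked v l → Blocked v (bubble x l)
bubble-blocked x<v (blocked as v≤bs) = bubble-++-blocked x<v as v≤bs

qAux-ltrMax-blocked : ∀ m xs (k : Fin (length xs)) → m < lookup xs k →
  IsLTRMax xs k → Blocked (lookup xs k) (qAux m xs)
qAux-ltrMax-blocked m (x ∷ xs) k m<xk ltr-k with m <ᵇ x | <ᵇ-reflects-< m x | k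
... | true  | ofʸ _   | Fin.zero  = bubble-blocked-self x (qAux x xs)
... | false | ofⁿ m≮x | Fin.zero  = ⊥-elim (m≮x m<xk)
... | true  | ofʸ _   | Fin.suc k =
  bubble-blocked x<xk (qAux-ltrMax-blocked x xs k x<xk (λ j j<k → ltr-k (Fin.suc j) (s<s j<k)))
  where x<xk = ltr-k Fin.zero z<s
... | false | ofⁿ _   | Fin.suc k =
  ∷-blocked x (qAux-ltrMax-blocked m xs k m<xk (λ j j<k → ltr-k (Fin.suc j) (s<s j<k)))

blocked-successor-larger : Blocked v l → Unique l → (i j : Fin (length l)) →
  lookup l i ≡ v → toℕ j ≡ suc (toℕ i) → v < lookup l j
blocked-successor-larger (blocked as v≤bs) = go as v≤bs
  where
  go : ∀ {v bs} as → v ≤head bs → Unique (as ++ v ∷ bs) → (i j : Fin (length (as ++ v ∷ bs))) →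
    lookup (as ++ v ∷ bs) i ≡ v → toℕ j ≡ suc (toℕ i) → v < lookup (as ++ v ∷ bs) j
  go [] (≤head-∷ v≤b) (v∉bs ∷ _) Fin.zero (Fin.suc Fin.zero) _ _ = ≤∧≢⇒< v≤b (All.head v∉bs)
  go [] ≤head-[] _ Fin.zero (Fin.suc ()) _ _
  go [] _ (v∉bs ∷ _) (Fin.suc i) _ bs[i]≡v _ = ⊥-elim (All.lookup v∉bs (∈-lookup i) (sym bs[i]≡v))
  go (a ∷ as) _ (a∉rest ∷ _) Fin.zero _ a≡v _ = ⊥-elim (All.lookup a∉rest (∈-++⁺ʳ as (here refl)) a≡v)
  go (a ∷ as) v≤bs (_ ∷ u) (Fin.suc i) (Fin.suc j) eq j≡1+i = go as v≤bs u i j eq (suc-injective j≡1+i)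

proposition3p2 : (n : ℕ) (σ π : List ℕ) → IsPerm n σ → π ≡ q σ →
    (i j : Fin (length π)) → toℕ j ≡ suc (toℕ i) →
    IsLTRMax π i → ¬ IsLTRMax π j → ¬ IsLTRMaxValue σ (lookup π i)
proposition3p2 n σ .(q σ) σ-perm refl i j j≡1+i ltr-i ¬ltr-j (k , σk≡πi , ltr-k) =
  ¬ltr-j (ltrMax-successor (q σ) i j j≡1+i ltr-i πi<πj)
  where
  σk-blocked : Blocked (lookup σ k) (q σ)
  σk-blocked = qAux-ltrMax-blocked 0 σ k (perm-positive n σ-perm (∈-lookup k)) ltr-k

  qσ-unique : Unique (q σ)
  qσ-unique = perm-unique n (↭-trans (qAux-↭ 0 σ) σ-perm)

  πi<πj : lookup (q σ) i < lookup (q σ) j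
  πi<πj = subst (_< lookup (q σ) j) σk≡πi
    (blocked-successor-larger σk-blocked qσ-unique i j (sym σk≡πi) j≡1+i)
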